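{- Let $k$ be a positive integer, $p$ a prime, $r\geq 0$ an integer, and $m$ an integer with $1\leq m<p^r$; set $n=kp^r+m$. Then $$k\left(\frac{p^r-1}{p-1}-r\right)+\frac{m}{p-1}-\lfloor\log_p m\rfloor-1\;\leq\;\nu_p\left[s(n+1,k+1)\right]\;\leq\; k\left(\frac{p^r-1}{p-1}-r\right)+\frac{m-1}{p-1}.$$
   Context: The Stirling numbers of the first kind $s(n,k)$ are defined by $x(x-1)\cdots(x-n+1)=\sum_{k=0}^n s(n,k)\,x^k$. For a prime $p$ and a nonzero integer $a$, $\nu_p(a)=\max\{j\in\mathbb{N}: p^j\mid a\}$ is the $p$-adic valuation. $\lfloor x\rfloor$ is the floor function and $\log_p$ the base-$p$ logarithm. -}

module Defs where

open import Data.Nat as ℕ using (ℕ; zero; suc; _^_; _≤?_)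
open import Data.Nat.Divisibility using (_∣?_)
open import Data.Integer as ℤ using (ℤ; +_; ∣_∣)
open import Data.Rational as ℚ using (ℚ)
open import Relation.Nullary using (yes; no)

-- Signed Stirling numbers of the first kind s(n,k):
-- x(x-1)...(x-n+1) = Σ_k s(n,k) x^k, equivalently
-- s(0,0)=1, s(0,k+1)=0, s(n+1,0)=0, s(n+1,k+1) = s(n,k) - n·s(n,k+1).
stirling1 : ℕ → ℕ → ℤ
stirling1 zero    zero    = + 1
stirling1 zero    (suc k) = + 0
stirling1 (suc n) zero    = + 0
stirling1 (suc n) (suc k) = stirling1 n k ℤ.- (+ n) ℤ.* stirling1 n (suc k)

maxPowDiv : ℕ → ℕ → ℕ → ℕ
maxPowDiv p a zero = zero
maxPowDiv p a (suc j) with (p ^ suc j) ∣? a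
... | yes _ = suc j
... | no  _ = maxPowDiv p a j

-- p-adic valuation ν_p(a) = max{ j : p^j ∣ a } for a ≠ 0 and p ≥ 2
-- (then p^j ∣ a forces j ≤ |a|, so the search over j ≤ |a| is exhaustive).
ν : ℕ → ℤ → ℕ
ν p a = maxPowDiv p ∣ a ∣ ∣ a ∣

maxPowLe : ℕ → ℕ → ℕ → ℕ
maxPowLe p m zero = zero
maxPowLe p m (suc j) with (p ^ suc j) ≤? m
... | yes _ = suc j
... | no  _ = maxPowLe p m j

-- ⌊log_p m⌋ = max{ j : p^j ≤ m } for m ≥ 1 and p ≥ 2 (p^j ≤ m forces j ≤ m).
⌊log_⌋ : ℕ → ℕ → ℕ
⌊log_⌋ p m = maxPowLe p m m

-- a / (p - 1) as a rational; only meaningful (and only used) for p ≥ 2.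
_/[_-1] : ℤ → ℕ → ℚ
a /[ suc (suc q) -1] = a ℚ./ suc q
a /[ _ -1] = ℚ.0ℚ

{-# OPTIONS --safe #-}
module Submission where

-- The polynomial (x − 1)(x − 2)⋯(x − n) has coefficients s(n + 1, j + 1). Build it one linear
-- factor at a time and follow a vertex of its p-adic Newton polygon: a coefficient of exact
-- valuation W at index t, the valuations growing by at least r per step to the left and
-- dropping by at most r − 1 per step to the right. A factor x − a with ν_p(a) < r keeps the
-- vertex at t and adds ν_p(a) to W; a factor with p^r ∣ a moves it to t + 1. For n = k p^r + m
-- exactly k of the factors x − i are of the second kind, which gives the exact formula
--   ν_p(s(n + 1, k + 1)) = k ν_p((p^r − 1)!) + ν_p(m!).
-- The bounds then follow from Legendre's formula (p − 1) ν_p(u!) = u − (digit sum of u):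
-- the digit sum of p^r − 1 is r(p − 1), and that of m lies between 1 and (p − 1)(⌊log_p m⌋ + 1).

open import Data.Empty using (⊥-elim)
open import Data.Integer as ℤ using (ℤ; +_; ∣_∣)
import Data.Integer.Divisibility.Signed as ℤ∣
import Data.Integer.Properties as ℤ
open import Data.Integer.Tactic.RingSolver as ℤ-Solver using ()
open import Data.Nat as ℕ
  using (ℕ; zero; suc; _+_; _*_; _^_; _∸_; _≤_; _<_; _≤?_; z≤n; s≤s; NonZero)
open import Data.Nat.Divisibility as ℕ∣ using (_∣_; _∣?_; divides)
open import Data.Nat.DivMod using (_/_; _%_; m≡m%n+[m/n]*n; m%n<n; m/n<m; m<n*o⇒m/o<n)
open import Data.Nat.Induction using (<-wellFounded)
open import Data.Nat.Primality using (Prime; euclidsLemma; prime⇒nonTrivial)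
open import Data.Nat.Properties
open import Data.Nat.Tactic.RingSolver using (solve-∀)
open import Data.Product using (_×_; _,_; proj₁; proj₂)
open import Data.Rational as ℚ using (ℚ)
import Data.Rational.Properties as ℚ
open import Data.Rational.Unnormalised as ℚᵘ using (mkℚᵘ; *≡*; *≤*)
import Data.Rational.Unnormalised.Properties as ℚᵘ
open import Data.Sum using (inj₁; inj₂)
open import Function using (_∘_)
open import Induction.WellFounded using (Acc; acc)
open import Relation.Binary.Definitions using (tri<; tri≈; tri>)
open import Relation.Binary.PropositionalEquality
open import Relation.Nullary using (¬_; yes; no)

open import Defs

maxPowDiv-∣ : ∀ p a b → p ^ maxPowDiv p a b ∣ a
maxPowDiv-∣ p a zero = ℕ∣.1∣ a
maxPowDiv-∣ p a (suc b) with p ^ suc b ∣? a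
... | yes p^b∣a = p^b∣a
... | no  _     = maxPowDiv-∣ p a b

maxPowDiv-maximal : ∀ p a b {i} → maxPowDiv p a b < i → i ≤ b → ¬ p ^ i ∣ a
maxPowDiv-maximal p a zero    lt i≤0 = ⊥-elim (<⇒≱ lt i≤0)
maxPowDiv-maximal p a (suc b) lt i≤b with p ^ suc b ∣? a | m≤n⇒m<n∨m≡n i≤b
... | yes _   | _          = ⊥-elim (<⇒≱ lt i≤b)
... | no  ¬∣  | inj₂ refl  = ¬∣
... | no  _   | inj₁ i<1+b = maxPowDiv-maximal p a b lt (≤-pred i<1+b)

maxPowLe-maximal : ∀ p m b {i} → maxPowLe p m b < i → i ≤ b → ¬ p ^ i ≤ m
maxPowLe-maximal p m zero    lt i≤0 = ⊥-elim (<⇒≱ lt i≤0)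
maxPowLe-maximal p m (suc b) lt i≤b with p ^ suc b ≤? m | m≤n⇒m<n∨m≡n i≤b
... | yes _   | _          = ⊥-elim (<⇒≱ lt i≤b)
... | no  ≰   | inj₂ refl  = ≰
... | no  _   | inj₁ i<1+b = maxPowLe-maximal p m b lt (≤-pred i<1+b)

-- p is written q + 2, so that p − 1 = suc q, as in the definition of _/[_-1].
module PAdic (q : ℕ) where

  p : ℕ
  p = suc (suc q)

  n<p^n : ∀ n → n < p ^ n
  n<p^n zero    = s≤s z≤n
  n<p^n (suc n) = ≤-trans (s≤s (n<p^n n)) (^-monoʳ-< p (s≤s (s≤s z≤n)) (n<1+n n))

  p^-mono-∣ : ∀ {e f} → e ≤ f → p ^ e ∣ p ^ f
  p^-mono-∣ {e} {f} e≤f = divides (p ^ (f ∸ e)) (begin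
    p ^ f               ≡⟨ cong (p ^_) (m∸n+n≡m e≤f) ⟨
    p ^ (f ∸ e + e)     ≡⟨ ^-distribˡ-+-* p (f ∸ e) e ⟩
    p ^ (f ∸ e) * p ^ e ∎)
    where open ≡-Reasoning

  p^-cancel-< : ∀ {e s} → p ^ e < p ^ s → e < s
  p^-cancel-< p^e<p^s = ≰⇒> (λ s≤e → <⇒≱ p^e<p^s (^-monoʳ-≤ p s≤e))

  1+[p^s∸1]≡p^s : ∀ s → suc (p ^ s ∸ 1) ≡ p ^ s
  1+[p^s∸1]≡p^s s = suc-pred (p ^ s) ⦃ m^n≢0 p s ⦄

  infix 4 p^_∥_
  p^_∥_ : ℕ → ℕ → Set
  p^ e ∥ a = (p ^ e ∣ a) × ¬ (p ^ suc e ∣ a)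

  ∥-unique : ∀ {e f a} → p^ e ∥ a → p^ f ∥ a → e ≡ f
  ∥-unique {e} {f} (p^e∣a , p^1+e∤a) (p^f∣a , p^1+f∤a) with <-cmp e f
  ... | tri< e<f _ _ = ⊥-elim (p^1+e∤a (ℕ∣.∣-trans (p^-mono-∣ e<f) p^f∣a))
  ... | tri≈ _ e≡f _ = e≡f
  ... | tri> _ _ f<e = ⊥-elim (p^1+f∤a (ℕ∣.∣-trans (p^-mono-∣ f<e) p^e∣a))

  ν-∥ : ∀ a → .{{NonZero a}} → p^ ν p (+ a) ∥ a
  ν-∥ a = maxPowDiv-∣ p a a , λ p^1+ν∣a →
    maxPowDiv-maximal p a a ≤-refl (<⇒≤ (<-≤-trans (n<p^n _) (ℕ∣.∣⇒≤ p^1+ν∣a))) p^1+ν∣a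

  ∥⇒ν≡ : ∀ {e} z → p^ e ∥ ∣ z ∣ → ν p z ≡ e
  ∥⇒ν≡ z p^e∥z with ∣ z ∣
  ... | zero  = ⊥-elim (proj₂ p^e∥z (ℕ∣._∣0 _))
  ... | suc a = ∥-unique (ν-∥ (suc a)) p^e∥z

  ∥-*p : ∀ {e a} → p^ e ∥ a → p^ suc e ∥ a * p
  ∥-*p {e} {a} (p^e∣a , p^1+e∤a) rewrite *-comm a p =
    ℕ∣.*-monoʳ-∣ p p^e∣a , λ p^2+e∣pa → p^1+e∤a (ℕ∣.*-cancelˡ-∣ p p^2+e∣pa)

  ∥-+-multiple : ∀ {e u s} t → e < s → p^ e ∥ u → p^ e ∥ t * p ^ s + u
  ∥-+-multiple {e} {u} {s} t e<s (p^e∣u , p^1+e∤u) =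
    ℕ∣.∣m∣n⇒∣m+n (ℕ∣.∣n⇒∣m*n t (p^-mono-∣ (<⇒≤ e<s))) p^e∣u ,
    λ p^1+e∣sum → p^1+e∤u (ℕ∣.∣m+n∣m⇒∣n p^1+e∣sum (ℕ∣.∣n⇒∣m*n t (p^-mono-∣ e<s)))

  ∥-unit : ∀ {d} Q → 0 < d → d < p → p^ 0 ∥ d + Q * p
  ∥-unit {d} Q 0<d d<p = ℕ∣.1∣ _ , λ p*1∣sum →
    let p∣d = ℕ∣.∣m+n∣m⇒∣n (subst₂ _∣_ (*-identityʳ p) (+-comm d (Q * p)) p*1∣sum) (ℕ∣.n∣m*n Q)
    in <⇒≱ d<p (ℕ∣.∣⇒≤ ⦃ ℕ.>-nonZero 0<d ⦄ p∣d)

  ∥-* : Prime p → ∀ {e f a b} → p^ e ∥ a → p^ f ∥ b → p^ (e + f) ∥ a * b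
  ∥-* p-prime {e} {f} {a} {b} (p^e∣a@(divides a′ a≡a′p^e) , p^1+e∤a)
                              (p^f∣b@(divides b′ b≡b′p^f) , p^1+f∤b) =
    subst (_∣ a * b) (sym (^-distribˡ-+-* p e f)) (ℕ∣.*-pres-∣ p^e∣a p^f∣b) , p^1+e+f∤ab
    where
      p^e*p^f : ℕ
      p^e*p^f = p ^ e * p ^ f
      rearrange : ∀ x y u v → (x * u) * (y * v) ≡ (x * y) * (u * v)
      rearrange = solve-∀
      p∣a′b′ : p ^ suc (e + f) ∣ a * b → p ∣ a′ * b′
      p∣a′b′ = ℕ∣.*-cancelʳ-∣ p^e*p^f ⦃ m*n≢0 (p ^ e) (p ^ f) ⦃ m^n≢0 p e ⦄ ⦃ m^n≢0 p f ⦄ ⦄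
             ∘ subst₂ _∣_ (cong (p *_) (^-distribˡ-+-* p e f))
                          (trans (cong₂ _*_ a≡a′p^e b≡b′p^f) (rearrange a′ b′ (p ^ e) (p ^ f)))
      p^1+e+f∤ab : ¬ p ^ suc (e + f) ∣ a * b
      p^1+e+f∤ab h with euclidsLemma a′ b′ p-prime (p∣a′b′ h)
      ... | inj₁ p∣a′ = p^1+e∤a (subst (p ^ suc e ∣_) (sym a≡a′p^e) (ℕ∣.*-monoˡ-∣ (p ^ e) p∣a′))
      ... | inj₂ p∣b′ = p^1+f∤b (subst (p ^ suc f ∣_) (sym b≡b′p^f) (ℕ∣.*-monoˡ-∣ (p ^ f) p∣b′))

  m<p^suc⌊log⌋m : ∀ m → m < p ^ suc (⌊log_⌋ p m)
  m<p^suc⌊log⌋m m with suc (⌊log_⌋ p m) ≤? m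
  ... | yes L<m = ≰⇒> (maxPowLe-maximal p m m ≤-refl L<m)
  ... | no  L≮m = <-trans (≰⇒> L≮m) (n<p^n _)

  -- A record rather than an alias for + (p ^ e) ∣ z, so that e can be inferred by unification.
  infix 4 p^_∣ᶻ_
  record p^_∣ᶻ_ (e : ℕ) (z : ℤ) : Set where
    constructor ∣⇒∣ᶻ
    field ∣ᶻ⇒∣ : + (p ^ e) ℤ∣.∣ z
  open p^_∣ᶻ_

  ∣ᶻ⇒∣ᵤ : ∀ {e z} → p^ e ∣ᶻ z → p ^ e ∣ ∣ z ∣
  ∣ᶻ⇒∣ᵤ = ℤ∣.∣⇒∣ᵤ ∘ ∣ᶻ⇒∣

  ∣ᵤ⇒∣ᶻ : ∀ {e z} → p ^ e ∣ ∣ z ∣ → p^ e ∣ᶻ z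
  ∣ᵤ⇒∣ᶻ = ∣⇒∣ᶻ ∘ ℤ∣.∣ᵤ⇒∣

  ∣ᶻ-refl : ∀ e → p^ e ∣ᶻ + (p ^ e)
  ∣ᶻ-refl e = ∣⇒∣ᶻ ℤ∣.∣-refl

  p^0∣ᶻ : ∀ {e} z → e ≡ 0 → p^ e ∣ᶻ z
  p^0∣ᶻ z refl = ∣⇒∣ᶻ (ℤ∣.divides z (sym (ℤ.*-identityʳ z)))

  ∣ᶻ0 : ∀ {e} → p^ e ∣ᶻ + 0
  ∣ᶻ0 = ∣⇒∣ᶻ (ℤ∣.divides (+ 0) refl)

  ∣ᶻ-weaken : ∀ {e f z} → e ≤ f → p^ f ∣ᶻ z → p^ e ∣ᶻ z
  ∣ᶻ-weaken e≤f (∣⇒∣ᶻ p^f∣z) = ∣⇒∣ᶻ (ℤ∣.∣-trans (ℤ∣.∣ᵤ⇒∣ (p^-mono-∣ e≤f)) p^f∣z)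

  ∣ᶻ-* : ∀ {e f x y} → p^ e ∣ᶻ x → p^ f ∣ᶻ y → p^ (e + f) ∣ᶻ x ℤ.* y
  ∣ᶻ-* {e} {f} {x} {y} p^e∣x p^f∣y = ∣ᵤ⇒∣ᶻ
    (subst₂ _∣_ (sym (^-distribˡ-+-* p e f)) (sym (ℤ.abs-* x y))
      (ℕ∣.*-pres-∣ (∣ᶻ⇒∣ᵤ p^e∣x) (∣ᶻ⇒∣ᵤ p^f∣y)))

  ∣ᶻ-*ˡ : ∀ {e} x {y} → p^ e ∣ᶻ y → p^ e ∣ᶻ x ℤ.* y
  ∣ᶻ-*ˡ x (∣⇒∣ᶻ p^e∣y) = ∣⇒∣ᶻ (ℤ∣.∣n⇒∣m*n x p^e∣y)

  ∣ᶻ-− : ∀ {e x y} → p^ e ∣ᶻ x → p^ e ∣ᶻ y → p^ e ∣ᶻ x ℤ.- y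
  ∣ᶻ-− (∣⇒∣ᶻ p^e∣x) (∣⇒∣ᶻ p^e∣y) = ∣⇒∣ᶻ (ℤ∣.∣m∣n⇒∣m-n p^e∣x p^e∣y)

  ∣ᶻ-*-− : ∀ {e} c {x y} → p^ e ∣ᶻ c ℤ.* x → p^ e ∣ᶻ c ℤ.* y → p^ e ∣ᶻ c ℤ.* (x ℤ.- y)
  ∣ᶻ-*-− {e} c {x} {y} p^e∣cx p^e∣cy =
    subst (p^ e ∣ᶻ_) (sym (distrib c x y)) (∣ᶻ-− p^e∣cx p^e∣cy)
    where
      distrib : ∀ c x y → c ℤ.* (x ℤ.- y) ≡ c ℤ.* x ℤ.- c ℤ.* y
      distrib = ℤ-Solver.solve-∀

  ∤ᶻ-−ʳ : ∀ {e x y} → p^ e ∣ᶻ x → ¬ p^ e ∣ᶻ y → ¬ p^ e ∣ᶻ x ℤ.- y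
  ∤ᶻ-−ʳ {y = y} (∣⇒∣ᶻ p^e∣x) p^e∤y (∣⇒∣ᶻ p^e∣x-y) = p^e∤y (∣⇒∣ᶻ
    (subst (_ ℤ∣.∣_) (ℤ.neg-involutive y) (ℤ∣.∣m⇒∣-m (ℤ∣.∣m+n∣m⇒∣n p^e∣x-y p^e∣x))))

  ∤ᶻ-−ˡ : ∀ {e x y} → ¬ p^ e ∣ᶻ x → p^ e ∣ᶻ y → ¬ p^ e ∣ᶻ x ℤ.- y
  ∤ᶻ-−ˡ p^e∤x (∣⇒∣ᶻ p^e∣y) (∣⇒∣ᶻ p^e∣x-y) =
    p^e∤x (∣⇒∣ᶻ (ℤ∣.∣m+n∣n⇒∣m p^e∣x-y (ℤ∣.∣m⇒∣-m p^e∣y)))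

  ∤ᶻ-* : Prime p → ∀ {e W a z} → p^ e ∥ a → p^ W ∣ᶻ z → ¬ p^ suc W ∣ᶻ z →
         ¬ p^ suc (e + W) ∣ᶻ + a ℤ.* z
  ∤ᶻ-* p-prime {e} {W} {a} {z} p^e∥a p^W∣z p^1+W∤z p^1+e+W∣az =
    proj₂ (∥-* p-prime {e} {W} p^e∥a (∣ᶻ⇒∣ᵤ p^W∣z , p^1+W∤z ∘ ∣ᵤ⇒∣ᶻ))
          (subst (p ^ suc (e + W) ∣_) (ℤ.abs-* (+ a) z) (∣ᶻ⇒∣ᵤ p^1+e+W∣az))

  +p^-+ : ∀ e f → + (p ^ (e + f)) ≡ + (p ^ e) ℤ.* + (p ^ f)
  +p^-+ e f = trans (cong +_ (^-distribˡ-+-* p e f)) (ℤ.pos-* (p ^ e) (p ^ f))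

  ν[_!] : ℕ → ℕ
  ν[ zero  !] = 0
  ν[ suc u !] = ν[ u !] + ν p (+ suc u)

  ν[d+Qp!]≡ν[Qp!] : ∀ Q {d} → d < p → ν[ d + Q * p !] ≡ ν[ Q * p !]
  ν[d+Qp!]≡ν[Qp!] Q {zero}  _   = refl
  ν[d+Qp!]≡ν[Qp!] Q {suc d} d<p = begin
    ν[ d + Q * p !] + ν p (+ suc (d + Q * p))
      ≡⟨ cong₂ _+_ (ν[d+Qp!]≡ν[Qp!] Q (<⇒≤ d<p)) (∥⇒ν≡ (+ suc (d + Q * p)) (∥-unit Q (s≤s z≤n) d<p)) ⟩
    ν[ Q * p !] + 0
      ≡⟨ +-identityʳ _ ⟩
    ν[ Q * p !] ∎
    where open ≡-Reasoning

  ν[Qp!]≡Q+ν[Q!] : ∀ Q → ν[ Q * p !] ≡ Q + ν[ Q !]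
  ν[Qp!]≡Q+ν[Q!] zero    = refl
  ν[Qp!]≡Q+ν[Q!] (suc Q) = begin
    ν[ suc q + Q * p !] + ν p (+ (suc Q * p))
      ≡⟨ cong₂ _+_ (ν[d+Qp!]≡ν[Qp!] Q ≤-refl) (∥⇒ν≡ (+ (suc Q * p)) (∥-*p {ν p (+ suc Q)} (ν-∥ (suc Q)))) ⟩
    ν[ Q * p !] + suc (ν p (+ suc Q))
      ≡⟨ cong (_+ suc (ν p (+ suc Q))) (ν[Qp!]≡Q+ν[Q!] Q) ⟩
    Q + ν[ Q !] + suc (ν p (+ suc Q))
      ≡⟨ regroup Q ν[ Q !] (ν p (+ suc Q)) ⟩
    suc Q + (ν[ Q !] + ν p (+ suc Q)) ∎
    where
      open ≡-Reasoning
      regroup : ∀ x y z → x + y + suc z ≡ suc x + (y + z)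
      regroup = solve-∀

  ν[m!]≡m/p+ν[m/p!] : ∀ m → ν[ m !] ≡ m / p + ν[ m / p !]
  ν[m!]≡m/p+ν[m/p!] m = begin
    ν[ m !]                 ≡⟨ cong ν[_!] (m≡m%n+[m/n]*n m p) ⟩
    ν[ m % p + m / p * p !] ≡⟨ ν[d+Qp!]≡ν[Qp!] (m / p) (m%n<n m p) ⟩
    ν[ m / p * p !]         ≡⟨ ν[Qp!]≡Q+ν[Q!] (m / p) ⟩
    m / p + ν[ m / p !]     ∎
    where open ≡-Reasoning

  [ν[p^s∸1!]+s]*[p-1]≡p^s∸1 : ∀ s → (ν[ p ^ s ∸ 1 !] + s) * suc q ≡ p ^ s ∸ 1
  [ν[p^s∸1!]+s]*[p-1]≡p^s∸1 zero    = refl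
  [ν[p^s∸1!]+s]*[p-1]≡p^s∸1 (suc s) = begin
    (ν[ X !] + suc s) * suc q
      ≡⟨ cong (λ x → (ν[ x !] + suc s) * suc q) X≡ ⟩
    (ν[ suc q + Y * p !] + suc s) * suc q
      ≡⟨ cong (λ v → (v + suc s) * suc q) (trans (ν[d+Qp!]≡ν[Qp!] Y ≤-refl) (ν[Qp!]≡Q+ν[Q!] Y)) ⟩
    (Y + ν[ Y !] + suc s) * suc q
      ≡⟨ regroup q Y ν[ Y !] s ⟩
    (ν[ Y !] + s) * suc q + suc (q + Y * suc q)
      ≡⟨ cong (_+ suc (q + Y * suc q)) ([ν[p^s∸1!]+s]*[p-1]≡p^s∸1 s) ⟩
    Y + suc (q + Y * suc q)
      ≡⟨ collect q Y ⟩
    suc q + Y * p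
      ≡⟨ X≡ ⟨
    X ∎
    where
      open ≡-Reasoning
      X Y : ℕ
      X = p ^ suc s ∸ 1
      Y = p ^ s ∸ 1
      X≡ : X ≡ suc q + Y * p
      X≡ = suc-injective (begin
        suc X        ≡⟨ 1+[p^s∸1]≡p^s (suc s) ⟩
        p * p ^ s    ≡⟨ *-comm p (p ^ s) ⟩
        p ^ s * p    ≡⟨ cong (_* p) (1+[p^s∸1]≡p^s s) ⟨
        suc Y * p    ∎)
      regroup : ∀ q y g s → (y + g + suc s) * suc q ≡ (g + s) * suc q + suc (q + y * suc q)
      regroup = solve-∀
      collect : ∀ q y → y + suc (q + y * suc q) ≡ suc q + y * suc (suc q)
      collect = solve-∀

  ν[m!]*[p-1]<m : ∀ m → 0 < m → ν[ m !] * suc q < m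
  ν[m!]*[p-1]<m m 0<m = go m 0<m (<-wellFounded m)
    where
      go : ∀ m → 0 < m → Acc _<_ m → ν[ m !] * suc q < m
      go m 0<m (acc smaller) with m / p in m/p≡ | ν[m!]≡m/p+ν[m/p!] m
      ... | zero  | ν[m!]≡ = subst (λ v → v * suc q < m) (sym ν[m!]≡) 0<m
      ... | suc Q | ν[m!]≡ = begin-strict
        ν[ m !] * suc q                      ≡⟨ cong (_* suc q) ν[m!]≡ ⟩
        (suc Q + ν[ suc Q !]) * suc q        ≡⟨ *-distribʳ-+ (suc q) (suc Q) ν[ suc Q !] ⟩
        suc Q * suc q + ν[ suc Q !] * suc q  <⟨ +-monoʳ-< (suc Q * suc q) IH ⟩
        suc Q * suc q + suc Q                ≡⟨ collect q (suc Q) ⟩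
        suc Q * p                            ≤⟨ m≤n+m (suc Q * p) (m % p) ⟩
        m % p + suc Q * p                    ≡⟨ cong (λ Q → m % p + Q * p) m/p≡ ⟨
        m % p + m / p * p                    ≡⟨ m≡m%n+[m/n]*n m p ⟨
        m                                    ∎
        where
          open ≤-Reasoning
          collect : ∀ q x → x * suc q + x ≡ x * suc (suc q)
          collect = solve-∀
          Q<m : suc Q < m
          Q<m = subst (_< m) m/p≡ (m/n<m m p ⦃ ℕ.>-nonZero 0<m ⦄ (s≤s (s≤s z≤n)))
          IH : ν[ suc Q !] * suc q < suc Q
          IH = go (suc Q) (s≤s z≤n) (smaller Q<m)

  m≤[ν[m!]+D]*[p-1] : ∀ D m → m < p ^ D → m ≤ (ν[ m !] + D) * suc q
  m≤[ν[m!]+D]*[p-1] zero    zero    _       = z≤n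
  m≤[ν[m!]+D]*[p-1] zero    (suc m) (s≤s ())
  m≤[ν[m!]+D]*[p-1] (suc D) m       m<p^1+D = begin
    m                                     ≡⟨ m≡m%n+[m/n]*n m p ⟩
    m % p + Q * p                         ≤⟨ +-monoˡ-≤ (Q * p) (≤-pred (m%n<n m p)) ⟩
    suc q + Q * p                         ≡⟨ regroup q Q ⟩
    suc Q * suc q + Q                     ≤⟨ +-monoʳ-≤ (suc Q * suc q) (m≤[ν[m!]+D]*[p-1] D Q Q<p^D) ⟩
    suc Q * suc q + (ν[ Q !] + D) * suc q ≡⟨ collect q Q ν[ Q !] D ⟩
    (Q + ν[ Q !] + suc D) * suc q         ≡⟨ cong (λ v → (v + suc D) * suc q) (ν[m!]≡m/p+ν[m/p!] m) ⟨
    (ν[ m !] + suc D) * suc q             ∎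
    where
      open ≤-Reasoning
      Q : ℕ
      Q = m / p
      Q<p^D : Q < p ^ D
      Q<p^D = m<n*o⇒m/o<n (subst (m <_) (*-comm p (p ^ D)) m<p^1+D)
      regroup : ∀ q x → suc q + x * suc (suc q) ≡ suc x * suc q + x
      regroup = solve-∀
      collect : ∀ q x g d → suc x * suc q + (g + d) * suc q ≡ (x + g + suc d) * suc q
      collect = solve-∀

-- Polynomials over ℤ as coefficient sequences: x* f is x·f and f *[x- a ] is f·(x − a).
x*_ : (ℕ → ℤ) → ℕ → ℤ
(x* f) zero    = + 0
(x* f) (suc j) = f j

infixl 7 _*[x-_]
_*[x-_] : (ℕ → ℤ) → ℤ → ℕ → ℤ
(f *[x- a ]) j = (x* f) j ℤ.- a ℤ.* f j

one : ℕ → ℤ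
one zero    = + 1
one (suc j) = + 0

-- stirling1⁺ n j is the coefficient of xʲ in (x − 1)(x − 2)⋯(x − n).
stirling1⁺ : ℕ → ℕ → ℤ
stirling1⁺ n j = stirling1 (suc n) (suc j)

stirling1⁺-zero : stirling1⁺ 0 ≗ one
stirling1⁺-zero zero    = refl
stirling1⁺-zero (suc j) = refl

stirling1⁺-suc : ∀ n → stirling1⁺ (suc n) ≗ stirling1⁺ n *[x- + suc n ]
stirling1⁺-suc n zero    = refl
stirling1⁺-suc n (suc j) = refl

module NewtonPolygon (q : ℕ) (p-prime : Prime (suc (suc q))) (r : ℕ) where

  open PAdic q

  -- In valuations: ν(f t) = W, ν(f (t − i)) ≥ W + r i and ν(f (t + i)) ≥ W − (r − 1) i.
  record Vertex (f : ℕ → ℤ) (t W : ℕ) : Set where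
    field
      left  : ∀ j i → j + i ≡ t → p^ (W + r * i) ∣ᶻ f j
      right : ∀ i → p^ (W + i) ∣ᶻ + (p ^ (r * i)) ℤ.* f (t + i)
      exact : ¬ p^ suc W ∣ᶻ f t
  open Vertex

  Vertex-resp-≗ : ∀ {f g t W} → f ≗ g → Vertex f t W → Vertex g t W
  Vertex-resp-≗ {t = t} f≗g V = record
    { left  = λ j i j+i≡t → subst (p^ _ ∣ᶻ_) (f≗g j) (left V j i j+i≡t)
    ; right = λ i → subst (λ z → p^ _ ∣ᶻ + (p ^ (r * i)) ℤ.* z) (f≗g (t + i)) (right V i)
    ; exact = λ p^1+W∣gt → exact V (subst (p^ _ ∣ᶻ_) (sym (f≗g t)) p^1+W∣gt)
    }

  vertex-∣ : ∀ {f t W} → Vertex f t W → p^ W ∣ᶻ f t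
  vertex-∣ {f} {t} {W} V = subst (λ e → p^ e ∣ᶻ f t)
    (trans (cong (_+_ W) (*-zeroʳ r)) (+-identityʳ W)) (left V t 0 (+-identityʳ t))

  vertex-ν : ∀ {f t W} → Vertex f t W → ν p (f t) ≡ W
  vertex-ν {f} {t} V = ∥⇒ν≡ (f t) (∣ᶻ⇒∣ᵤ (vertex-∣ V) , exact V ∘ ∣ᵤ⇒∣ᶻ)

  vertex-x* : ∀ {f t W} → Vertex f t W → p^ (W + r) ∣ᶻ (x* f) t
  vertex-x* {t = zero}          V = ∣ᶻ0
  vertex-x* {t = suc t} {W = W} V =
    subst (λ e → p^ (W + e) ∣ᶻ _) (*-identityʳ r) (left V t 1 (+-comm t 1))

  vertex-one : Vertex one 0 0
  vertex-one .left zero zero refl = p^0∣ᶻ (+ 1) (*-zeroʳ r)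
  vertex-one .right zero    = p^0∣ᶻ _ refl
  vertex-one .right (suc i) = subst (p^ suc i ∣ᶻ_) (sym (ℤ.*-zeroʳ (+ (p ^ (r * suc i))))) ∣ᶻ0
  vertex-one .exact p∣1 with ℕ∣.∣⇒≤ (∣ᶻ⇒∣ᵤ p∣1)
  ... | s≤s ()

  +p^-*-suc : ∀ i x → + (p ^ (r * suc i)) ℤ.* x ≡ + (p ^ r) ℤ.* (+ (p ^ (r * i)) ℤ.* x)
  +p^-*-suc i x = begin
    + (p ^ (r * suc i)) ℤ.* x                ≡⟨ cong (λ k → + (p ^ k) ℤ.* x) (*-suc r i) ⟩
    + (p ^ (r + r * i)) ℤ.* x                ≡⟨ cong (ℤ._* x) (+p^-+ r (r * i)) ⟩
    + (p ^ r) ℤ.* + (p ^ (r * i)) ℤ.* x      ≡⟨ ℤ.*-assoc (+ (p ^ r)) (+ (p ^ (r * i))) x ⟩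
    + (p ^ r) ℤ.* (+ (p ^ (r * i)) ℤ.* x)    ∎
    where open ≡-Reasoning

  vertex-*[x-]-ν<r : ∀ {f t W e a} → Vertex f t W → p^ e ∥ a → e < r → Vertex (f *[x- + a ]) t (W + e)
  vertex-*[x-]-ν<r {f} {t} {W} {e} {a} V p^e∥a e<r =
    record { left = left′ ; right = right′ ; exact = exact′ }
    where
      p^e∣a : p^ e ∣ᶻ + a
      p^e∣a = ∣ᵤ⇒∣ᶻ (proj₁ p^e∥a)

      swap : ∀ x y z → x + (y + z) ≡ y + x + z
      swap = solve-∀

      swap-factors : ∀ c a y → c ℤ.* (a ℤ.* y) ≡ a ℤ.* (c ℤ.* y)
      swap-factors = ℤ-Solver.solve-∀

      left′ : ∀ j i → j + i ≡ t → p^ (W + e + r * i) ∣ᶻ (f *[x- + a ]) j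
      left′ j i j+i≡t = ∣ᶻ-− (x*-part j j+i≡t)
        (subst (λ k → p^ k ∣ᶻ + a ℤ.* f j) (swap e W (r * i)) (∣ᶻ-* p^e∣a (left V j i j+i≡t)))
        where
          x*-part : ∀ j → j + i ≡ t → p^ (W + e + r * i) ∣ᶻ (x* f) j
          x*-part zero    _       = ∣ᶻ0
          x*-part (suc j) 1+j+i≡t = ∣ᶻ-weaken (begin
            W + e + r * i     ≤⟨ +-monoˡ-≤ (r * i) (+-monoʳ-≤ W (<⇒≤ e<r)) ⟩
            W + r + r * i     ≡⟨ +-assoc W r (r * i) ⟩
            W + (r + r * i)   ≡⟨ cong (_+_ W) (*-suc r i) ⟨
            W + r * suc i     ∎) (left V j (suc i) (trans (+-suc j i) 1+j+i≡t))
            where open ≤-Reasoning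

      right′ : ∀ i → p^ (W + e + i) ∣ᶻ + (p ^ (r * i)) ℤ.* (f *[x- + a ]) (t + i)
      right′ i = ∣ᶻ-*-− (+ (p ^ (r * i))) (x*-part i)
        (subst (λ k → p^ k ∣ᶻ + (p ^ (r * i)) ℤ.* (+ a ℤ.* f (t + i))) (swap e W i)
          (subst (p^ e + (W + i) ∣ᶻ_) (sym (swap-factors (+ (p ^ (r * i))) (+ a) (f (t + i))))
            (∣ᶻ-* p^e∣a (right V i))))
        where
          x*-part : ∀ i → p^ (W + e + i) ∣ᶻ + (p ^ (r * i)) ℤ.* (x* f) (t + i)
          x*-part zero rewrite +-identityʳ t = ∣ᶻ-*ˡ (+ (p ^ (r * 0)))
            (∣ᶻ-weaken (≤-trans (≤-reflexive (+-identityʳ (W + e))) (+-monoʳ-≤ W (<⇒≤ e<r))) (vertex-x* V))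
          x*-part (suc i) rewrite +-suc t i = ∣ᶻ-weaken (begin
              W + e + suc i   ≡⟨ +-suc (W + e) i ⟩
              suc (W + e + i) ≡⟨ cong suc (swap e W i) ⟨
              suc e + (W + i) ≤⟨ +-monoˡ-≤ (W + i) e<r ⟩
              r + (W + i)     ∎)
            (subst (p^ r + (W + i) ∣ᶻ_) (sym (+p^-*-suc i (f (t + i)))) (∣ᶻ-* (∣ᶻ-refl r) (right V i)))
            where open ≤-Reasoning

      exact′ : ¬ p^ suc (W + e) ∣ᶻ (f *[x- + a ]) t
      exact′ = ∤ᶻ-−ʳ
        (∣ᶻ-weaken (≤-trans (≤-reflexive (sym (+-suc W e))) (+-monoʳ-≤ W e<r)) (vertex-x* V))
        (subst (λ k → ¬ p^ suc k ∣ᶻ + a ℤ.* f t) (+-comm e W) (∤ᶻ-* p-prime p^e∥a (vertex-∣ V) (exact V)))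

  vertex-*[x-]-p^r∣ : ∀ {f t W a} → Vertex f t W → p ^ r ∣ a → Vertex (f *[x- + a ]) (suc t) W
  vertex-*[x-]-p^r∣ {f} {t} {W} {a} V p^r∣a@(divides a′ a≡a′p^r) =
    record { left = left′ ; right = right′ ; exact = exact′ }
    where
      p^r∣ᶻa : p^ r ∣ᶻ + a
      p^r∣ᶻa = ∣ᵤ⇒∣ᶻ p^r∣a

      a-scaled : ∀ i y → + (p ^ (r * i)) ℤ.* (+ a ℤ.* y) ≡ + a′ ℤ.* (+ (p ^ (r * suc i)) ℤ.* y)
      a-scaled i y = begin
        + (p ^ (r * i)) ℤ.* (+ a ℤ.* y)
          ≡⟨ cong (λ c → + (p ^ (r * i)) ℤ.* (c ℤ.* y)) (trans (cong +_ a≡a′p^r) (ℤ.pos-* a′ (p ^ r))) ⟩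
        + (p ^ (r * i)) ℤ.* (+ a′ ℤ.* + (p ^ r) ℤ.* y)
          ≡⟨ regroup (+ (p ^ (r * i))) (+ a′) (+ (p ^ r)) y ⟩
        + a′ ℤ.* (+ (p ^ r) ℤ.* (+ (p ^ (r * i)) ℤ.* y))
          ≡⟨ cong (+ a′ ℤ.*_) (+p^-*-suc i y) ⟨
        + a′ ℤ.* (+ (p ^ (r * suc i)) ℤ.* y) ∎
        where
          open ≡-Reasoning
          regroup : ∀ c a′ P y → c ℤ.* (a′ ℤ.* P ℤ.* y) ≡ a′ ℤ.* (P ℤ.* (c ℤ.* y))
          regroup = ℤ-Solver.solve-∀

      a-part : ∀ i → p^ (W + suc i) ∣ᶻ + (p ^ (r * i)) ℤ.* (+ a ℤ.* f (suc (t + i)))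
      a-part i rewrite a-scaled i (f (suc (t + i))) | sym (+-suc t i) = ∣ᶻ-*ˡ (+ a′) (right V (suc i))

      a-next : p^ suc W ∣ᶻ + a ℤ.* f (suc t)
      a-next = subst₂ p^_∣ᶻ_ (+-comm W 1) drop-p^0 (a-part 0)
        where
          drop-p^0 : + (p ^ (r * 0)) ℤ.* (+ a ℤ.* f (suc (t + 0))) ≡ + a ℤ.* f (suc t)
          drop-p^0 rewrite *-zeroʳ r | +-identityʳ t = ℤ.*-identityˡ (+ a ℤ.* f (suc t))

      left′ : ∀ j i → j + i ≡ suc t → p^ (W + r * i) ∣ᶻ (f *[x- + a ]) j
      left′ j i j+i≡1+t = ∣ᶻ-− (x*-part j j+i≡1+t) (a-part′ i j+i≡1+t)
        where
          x*-part : ∀ j → j + i ≡ suc t → p^ (W + r * i) ∣ᶻ (x* f) j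
          x*-part zero    _         = ∣ᶻ0
          x*-part (suc j) 1+j+i≡1+t = left V j i (suc-injective 1+j+i≡1+t)
          a-part′ : ∀ i → j + i ≡ suc t → p^ (W + r * i) ∣ᶻ + a ℤ.* f j
          a-part′ zero j+0≡1+t with trans (sym (+-identityʳ j)) j+0≡1+t
          ... | refl = ∣ᶻ-weaken
            (≤-trans (≤-reflexive (trans (cong (_+_ W) (*-zeroʳ r)) (+-identityʳ W))) (n≤1+n W)) a-next
          a-part′ (suc i) j+1+i≡1+t = subst (λ k → p^ k ∣ᶻ + a ℤ.* f j) (regroup W r i)
            (∣ᶻ-* p^r∣ᶻa (left V j i (suc-injective (trans (sym (+-suc j i)) j+1+i≡1+t))))
            where
              regroup : ∀ W r i → r + (W + r * i) ≡ W + r * suc i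
              regroup = solve-∀

      right′ : ∀ i → p^ (W + i) ∣ᶻ + (p ^ (r * i)) ℤ.* (f *[x- + a ]) (suc t + i)
      right′ i = ∣ᶻ-*-− (+ (p ^ (r * i))) (right V i) (∣ᶻ-weaken (+-monoʳ-≤ W (n≤1+n i)) (a-part i))

      exact′ : ¬ p^ suc W ∣ᶻ (f *[x- + a ]) (suc t)
      exact′ = ∤ᶻ-−ˡ (exact V) a-next

  vertex-stirling1⁺ : ∀ t u → u < p ^ r →
                      Vertex (stirling1⁺ (t * p ^ r + u)) t (t * ν[ p ^ r ∸ 1 !] + ν[ u !])
  vertex-stirling1⁺ zero zero _ = Vertex-resp-≗ (sym ∘ stirling1⁺-zero) vertex-one
  vertex-stirling1⁺ t (suc u) 1+u<p^r =
    subst₂ (λ n → Vertex (stirling1⁺ n) t)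
      (sym (+-suc (t * p ^ r) u)) (+-assoc (t * ν[ p ^ r ∸ 1 !]) ν[ u !] e)
      (Vertex-resp-≗ (sym ∘ stirling1⁺-suc n)
        (vertex-*[x-]-ν<r (vertex-stirling1⁺ t u (<-trans (n<1+n u) 1+u<p^r)) p^e∥1+n e<r))
    where
      n e : ℕ
      n = t * p ^ r + u
      e = ν p (+ suc u)
      e<r : e < r
      e<r = p^-cancel-< (≤-<-trans (ℕ∣.∣⇒≤ (proj₁ (ν-∥ (suc u)))) 1+u<p^r)
      p^e∥1+n : p^ e ∥ suc n
      p^e∥1+n = subst (p^ e ∥_) (+-suc (t * p ^ r) u) (∥-+-multiple t e<r (ν-∥ (suc u)))
  vertex-stirling1⁺ (suc t) zero _ =
    subst₂ (λ n → Vertex (stirling1⁺ n) (suc t)) (trans 1+n≡ (sym (+-identityʳ _))) W≡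
      (Vertex-resp-≗ (sym ∘ stirling1⁺-suc n)
        (vertex-*[x-]-p^r∣ (vertex-stirling1⁺ t X X<p^r) (subst (p ^ r ∣_) (sym 1+n≡) (ℕ∣.n∣m*n (suc t)))))
    where
      X n : ℕ
      X = p ^ r ∸ 1
      n = t * p ^ r + X
      X<p^r : X < p ^ r
      X<p^r = ≤-reflexive (1+[p^s∸1]≡p^s r)
      1+n≡ : suc n ≡ suc t * p ^ r
      1+n≡ = begin
        suc (t * p ^ r + X)   ≡⟨ +-suc (t * p ^ r) X ⟨
        t * p ^ r + suc X     ≡⟨ cong (_+_ (t * p ^ r)) (1+[p^s∸1]≡p^s r) ⟩
        t * p ^ r + p ^ r     ≡⟨ +-comm (t * p ^ r) (p ^ r) ⟩
        suc t * p ^ r         ∎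
        where open ≡-Reasoning
      W≡ : t * ν[ X !] + ν[ X !] ≡ suc t * ν[ X !] + 0
      W≡ = trans (+-comm (t * ν[ X !]) ν[ X !]) (sym (+-identityʳ _))

  ν-stirling1 : ∀ k m → m < p ^ r →
                ν p (stirling1 (k * p ^ r + m + 1) (k + 1)) ≡ k * ν[ p ^ r ∸ 1 !] + ν[ m !]
  ν-stirling1 k m m<p^r rewrite +-comm (k * p ^ r + m) 1 | +-comm k 1 =
    vertex-ν (vertex-stirling1⁺ k m m<p^r)

fromℚᵘ-homo-+ : ∀ u v → ℚ.fromℚᵘ (u ℚᵘ.+ v) ≡ ℚ.fromℚᵘ u ℚ.+ ℚ.fromℚᵘ v
fromℚᵘ-homo-+ u v = ℚ.toℚᵘ-injective (ℚᵘ.≃-trans (ℚ.toℚᵘ-fromℚᵘ (u ℚᵘ.+ v)) (ℚᵘ.≃-sym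
  (ℚᵘ.≃-trans (ℚ.toℚᵘ-homo-+ (ℚ.fromℚᵘ u) (ℚ.fromℚᵘ v)) (ℚᵘ.+-cong (ℚ.toℚᵘ-fromℚᵘ u) (ℚ.toℚᵘ-fromℚᵘ v)))))

fromℚᵘ-homo-* : ∀ u v → ℚ.fromℚᵘ (u ℚᵘ.* v) ≡ ℚ.fromℚᵘ u ℚ.* ℚ.fromℚᵘ v
fromℚᵘ-homo-* u v = ℚ.toℚᵘ-injective (ℚᵘ.≃-trans (ℚ.toℚᵘ-fromℚᵘ (u ℚᵘ.* v)) (ℚᵘ.≃-sym
  (ℚᵘ.≃-trans (ℚ.toℚᵘ-homo-* (ℚ.fromℚᵘ u) (ℚ.fromℚᵘ v)) (ℚᵘ.*-cong (ℚ.toℚᵘ-fromℚᵘ u) (ℚ.toℚᵘ-fromℚᵘ v)))))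

fromℚᵘ-homo‿- : ∀ u → ℚ.fromℚᵘ (ℚᵘ.- u) ≡ ℚ.- ℚ.fromℚᵘ u
fromℚᵘ-homo‿- u = ℚ.toℚᵘ-injective (ℚᵘ.≃-trans (ℚ.toℚᵘ-fromℚᵘ (ℚᵘ.- u)) (ℚᵘ.≃-sym
  (ℚᵘ.≃-trans (ℚ.toℚᵘ-homo‿- (ℚ.fromℚᵘ u)) (ℚᵘ.-‿cong (ℚ.toℚᵘ-fromℚᵘ u)))))

/-cross-≤ : ∀ {a b m n} → a ℤ.* + suc n ℤ.≤ b ℤ.* + suc m → a ℚ./ suc m ℚ.≤ b ℚ./ suc n
/-cross-≤ {a} {b} {m} {n} le = ℚ.toℚᵘ-cancel-≤
  (ℚᵘ.≤-respˡ-≃ (ℚᵘ.≃-sym (ℚ.toℚᵘ-fromℚᵘ (mkℚᵘ a m)))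
    (ℚᵘ.≤-respʳ-≃ (ℚᵘ.≃-sym (ℚ.toℚᵘ-fromℚᵘ (mkℚᵘ b n))) (*≤* le)))

ι : ℤ → ℚ
ι z = z ℚ./ 1

-- Each ι z and z ℚ./ suc n is definitionally fromℚᵘ (mkℚᵘ z n), which is how the
-- homomorphism lemmas above apply.
ι-+ : ∀ a b → ι a ℚ.+ ι b ≡ ι (a ℤ.+ b)
ι-+ a b = trans (sym (fromℚᵘ-homo-+ (mkℚᵘ a 0) (mkℚᵘ b 0)))
  (cong ι (cong₂ ℤ._+_ (ℤ.*-identityʳ a) (ℤ.*-identityʳ b)))

ι-* : ∀ a b → ι a ℚ.* ι b ≡ ι (a ℤ.* b)
ι-* a b = sym (fromℚᵘ-homo-* (mkℚᵘ a 0) (mkℚᵘ b 0))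

ι-− : ∀ a b → ι a ℚ.- ι b ≡ ι (a ℤ.- b)
ι-− a b = trans (cong (ι a ℚ.+_) (sym (fromℚᵘ-homo‿- (mkℚᵘ b 0)))) (ι-+ a (ℤ.- b))

ι-≤-/ : ∀ a b n → a ℤ.* + suc n ℤ.≤ b → ι a ℚ.≤ b ℚ./ suc n
ι-≤-/ a b n le = /-cross-≤ {a} {b} {0} {n} (subst (a ℤ.* + suc n ℤ.≤_) (sym (ℤ.*-identityʳ b)) le)

/-≤-ι : ∀ a b n → a ℤ.≤ b ℤ.* + suc n → a ℚ./ suc n ℚ.≤ ι b
/-≤-ι a b n le = /-cross-≤ {a} {b} {n} {0} (subst (ℤ._≤ b ℤ.* + suc n) (sym (ℤ.*-identityʳ a)) le)

/-≡-ι : ∀ a b n → a ≡ b ℤ.* + suc n → a ℚ./ suc n ≡ ι b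
/-≡-ι a b n eq = ℚ.fromℚᵘ-cong {mkℚᵘ a n} {mkℚᵘ b 0} (*≡* (trans (ℤ.*-identityʳ a) eq))

module RationalBounds (q : ℕ) where

  open PAdic q

  k*[[p^r-1]/[p-1]-r]≡k*ν[p^r∸1!] : ∀ k r →
    ι (+ k) ℚ.* ((+ (p ^ r) ℤ.- + 1) /[ p -1] ℚ.- ι (+ r)) ≡ ι (+ (k * ν[ p ^ r ∸ 1 !]))
  k*[[p^r-1]/[p-1]-r]≡k*ν[p^r∸1!] k r = begin
    ι (+ k) ℚ.* ((+ (p ^ r) ℤ.- + 1) /[ p -1] ℚ.- ι (+ r))
      ≡⟨ cong (λ z → ι (+ k) ℚ.* (z /[ p -1] ℚ.- ι (+ r))) +p^r-1≡+X ⟩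
    ι (+ k) ℚ.* ((+ X) /[ p -1] ℚ.- ι (+ r))
      ≡⟨ cong (λ x → ι (+ k) ℚ.* (x ℚ.- ι (+ r))) (/-≡-ι (+ X) (+ (G + r)) q +X≡) ⟩
    ι (+ k) ℚ.* (ι (+ G ℤ.+ + r) ℚ.- ι (+ r))
      ≡⟨ cong (ι (+ k) ℚ.*_) (ι-− (+ G ℤ.+ + r) (+ r)) ⟩
    ι (+ k) ℚ.* ι (+ G ℤ.+ + r ℤ.- + r)
      ≡⟨ ι-* (+ k) (+ G ℤ.+ + r ℤ.- + r) ⟩
    ι (+ k ℤ.* (+ G ℤ.+ + r ℤ.- + r))
      ≡⟨ cong ι (cancel (+ k) (+ G) (+ r)) ⟩
    ι (+ k ℤ.* + G)
      ≡⟨ cong ι (ℤ.pos-* k G) ⟨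
    ι (+ (k * G)) ∎
    where
      open ≡-Reasoning
      X G : ℕ
      X = p ^ r ∸ 1
      G = ν[ X !]
      +p^r-1≡+X : + (p ^ r) ℤ.- + 1 ≡ + X
      +p^r-1≡+X = trans (ℤ.m-n≡m⊖n (p ^ r) 1) (ℤ.⊖-≥ (m^n>0 p r))
      +X≡ : + X ≡ + (G + r) ℤ.* + suc q
      +X≡ = trans (cong +_ (sym ([ν[p^s∸1!]+s]*[p-1]≡p^s∸1 r))) (ℤ.pos-* (G + r) (suc q))
      cancel : ∀ k g r → k ℤ.* (g ℤ.+ r ℤ.- r) ≡ k ℤ.* g
      cancel = ℤ-Solver.solve-∀

  lower-bound : ∀ {A} K G L m → A ≡ ι (+ K) → m ≤ (G + suc L) * suc q →
                ((A ℚ.+ (+ m) /[ p -1]) ℚ.- ι (+ L)) ℚ.- ℚ.1ℚ ℚ.≤ ι (+ (K + G))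
  lower-bound K G L m refl m≤ = begin
    ι (+ K) ℚ.+ (+ m) /[ p -1] ℚ.- ι (+ L) ℚ.- ι (+ 1)
      ≤⟨ ℚ.+-monoˡ-≤ _ (ℚ.+-monoˡ-≤ _ (ℚ.+-monoʳ-≤ (ι (+ K)) (/-≤-ι (+ m) (+ (G + suc L)) q +m≤))) ⟩
    ι (+ K) ℚ.+ ι (+ (G + suc L)) ℚ.- ι (+ L) ℚ.- ι (+ 1)
      ≡⟨ cong (λ x → x ℚ.- ι (+ L) ℚ.- ι (+ 1)) (ι-+ (+ K) (+ (G + suc L))) ⟩
    ι (+ (K + (G + suc L))) ℚ.- ι (+ L) ℚ.- ι (+ 1)
      ≡⟨ cong (ℚ._- ι (+ 1)) (ι-− (+ (K + (G + suc L))) (+ L)) ⟩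
    ι (+ (K + (G + suc L)) ℤ.- + L) ℚ.- ι (+ 1)
      ≡⟨ ι-− (+ (K + (G + suc L)) ℤ.- + L) (+ 1) ⟩
    ι (+ (K + (G + suc L)) ℤ.- + L ℤ.- + 1)
      ≡⟨ cong ι (cancel (+ K) (+ G) (+ L)) ⟩
    ι (+ (K + G)) ∎
    where
      open ℚ.≤-Reasoning
      +m≤ : + m ℤ.≤ + (G + suc L) ℤ.* + suc q
      +m≤ = subst (+ m ℤ.≤_) (ℤ.pos-* (G + suc L) (suc q)) (ℤ.+≤+ m≤)
      cancel : ∀ k g l → k ℤ.+ (g ℤ.+ (+ 1 ℤ.+ l)) ℤ.- l ℤ.- + 1 ≡ k ℤ.+ g
      cancel = ℤ-Solver.solve-∀

  upper-bound : ∀ {A} K G m → A ≡ ι (+ K) → G * suc q < m →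
                ι (+ (K + G)) ℚ.≤ A ℚ.+ (+ m ℤ.- + 1) /[ p -1]
  upper-bound K G (suc m) refl G<1+m = begin
    ι (+ (K + G))              ≡⟨ ι-+ (+ K) (+ G) ⟨
    ι (+ K) ℚ.+ ι (+ G)        ≤⟨ ℚ.+-monoʳ-≤ (ι (+ K)) (ι-≤-/ (+ G) (+ m) q +G≤) ⟩
    ι (+ K) ℚ.+ (+ m) /[ p -1] ∎
    where
      open ℚ.≤-Reasoning
      +G≤ : + G ℤ.* + suc q ℤ.≤ + m
      +G≤ = subst (ℤ._≤ + m) (ℤ.pos-* G (suc q)) (ℤ.+≤+ (≤-pred G<1+m))

mainTheorem10 : (k p r m : ℕ) → 1 ≤ k → Prime p → 1 ≤ m → m < p ^ r →
    let n = k * p ^ r + m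
        A = ((+ k) ℚ./ 1) ℚ.* ((((+ (p ^ r)) ℤ.- (+ 1)) /[ p -1]) ℚ.- ((+ r) ℚ./ 1))
        v = ((+ ν p (stirling1 (n + 1) (k + 1))) ℚ./ 1)
    in ((A ℚ.+ ((+ m) /[ p -1])) ℚ.- ((+ ⌊log_⌋ p m) ℚ./ 1) ℚ.- ℚ.1ℚ) ℚ.≤ v
       × v ℚ.≤ (A ℚ.+ (((+ m) ℤ.- (+ 1)) /[ p -1]))
mainTheorem10 k (suc (suc q)) r m _ p-prime 0<m m<p^r
  rewrite NewtonPolygon.ν-stirling1 q p-prime r k m m<p^r =
    lower-bound K ν[ m !] (⌊log_⌋ p m) m (k*[[p^r-1]/[p-1]-r]≡k*ν[p^r∸1!] k r)
      (m≤[ν[m!]+D]*[p-1] _ m (m<p^suc⌊log⌋m m))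
  , upper-bound K ν[ m !] m (k*[[p^r-1]/[p-1]-r]≡k*ν[p^r∸1!] k r) (ν[m!]*[p-1]<m m 0<m)
  where
    open PAdic q
    open RationalBounds q
    K : ℕ
    K = k * ν[ p ^ r ∸ 1 !]
mainTheorem10 k 0 r m _ p-prime = ⊥-elim (ℕ.NonTrivial.nonTrivial (prime⇒nonTrivial p-prime))
mainTheorem10 k 1 r m _ p-prime = ⊥-elim (ℕ.NonTrivial.nonTrivial (prime⇒nonTrivial p-prime))
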